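{- If $n\geq 2$, then $B(P_2 \square P_n) = 2$ if $n = 2$, and $B(P_2 \square P_n) = 3$ if $n\geq 3$.
   Context: $P_n$ is the path on $n$ vertices. The Cartesian product $G\square H$ has vertex set $V(G)\times V(H)$, with $(u,v)$ adjacent to $(x,y)$ iff either $ux\in E(G)$ and $v=y$, or $u=x$ and $vy\in E(H)$. Bodyguards and Presidents is a two-player game on a finite simple graph $G$. One player controls a set of tokens called bodyguards, the other a single token called the president. First all bodyguards are placed on vertices (several may share a vertex), then the president is placed. The players then alternate turns, bodyguards first; on a player's turn, each token they control either moves to an adjacent vertex or stays put. The president is surrounded if every vertex of the open neighbourhood of the president's vertex is occupied by a bodyguard. The bodyguards win if there is a finite time after which, at the end of every bodyguard turn, the president is surrounded; otherwise the president wins. The bodyguard number $B(G)$ is the minimum number of bodyguards that guarantees a win for the bodyguards on $G$. -}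

module Defs where

open import Data.Nat using (ℕ; zero; suc; _≤_; _<_)
open import Data.Fin using (Fin; toℕ)
open import Data.Product using (_×_; _,_; ∃; ∃-syntax; Σ; proj₁; proj₂)
open import Data.Sum using (_⊎_)
open import Data.List using (List; []; _∷_)
open import Relation.Binary.PropositionalEquality using (_≡_)
open import Relation.Nullary using (¬_)

record Graph : Set₁ where
  field
    V   : Set
    Adj : V → V → Set

open Graph public

PathAdj : (n : ℕ) → Fin n → Fin n → Set
PathAdj n i j = (toℕ j ≡ suc (toℕ i)) ⊎ (toℕ i ≡ suc (toℕ j))

Path : ℕ → Graph
Path n = record { V = Fin n ; Adj = PathAdj n }

_□_ : Graph → Graph → Graph
G □ H = record
  { V   = V G × V H
  ; Adj = λ { (u , v) (x , y) → (Adj G u x × v ≡ y) ⊎ (u ≡ x × Adj H v y) } }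

module Game (G : Graph) (k : ℕ) where

  -- positions of the k bodyguards (several may share a vertex)
  Guards : Set
  Guards = Fin k → V G

  Step : V G → V G → Set
  Step u v = (u ≡ v) ⊎ Adj G u v

  -- past positions (most recent first): pairs (bodyguards, president)
  History : Set
  History = List (Guards × V G)

  Surrounded : V G → Guards → Set
  Surrounded p b = ∀ v → Adj G p v → ∃[ i ] (b i ≡ v)

  record BStrategy : Set where
    field
      place : Guards
      move  : Guards → V G → History → Guards
      legal : ∀ b p h i → Step (b i) (move b p h i)

  record PStrategy : Set where
    field
      place : Guards → V G
      -- current president, new guards, history (including previous state) ↦ new president
      move  : V G → Guards → History → V G
      legal : ∀ p b h → Step p (move p b h)

  record State : Set where
    constructor st
    field
      guards : Guards
      pres   : V G
      hist   : History

  -- state at the end of round t (after the president's move);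
  -- round 0 is the initial placement.
  play : BStrategy → PStrategy → ℕ → State
  play σ τ zero = st b₀ (PStrategy.place τ b₀) []
    where b₀ = BStrategy.place σ
  play σ τ (suc t) with play σ τ t
  ... | st b p h = st b' (PStrategy.move τ p b' h') h'
    where
      b' = BStrategy.move σ b p h
      h' = (b , p) ∷ h

  -- guards after the bodyguard turn of round t+1
  guardsAfter : BStrategy → PStrategy → ℕ → Guards
  guardsAfter σ τ t = State.guards (play σ τ (suc t))

  -- president position during the bodyguard turn of round t+1
  presBefore : BStrategy → PStrategy → ℕ → V G
  presBefore σ τ t = State.pres (play σ τ t)

  WinsAgainst : BStrategy → PStrategy → Set
  WinsAgainst σ τ = ∃[ T ] (∀ t → T ≤ t → Surrounded (presBefore σ τ t) (guardsAfter σ τ t))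

  BodyguardsWin : Set
  BodyguardsWin = Σ BStrategy λ σ → (τ : PStrategy) → WinsAgainst σ τ

Win : Graph → ℕ → Set
Win G k = Game.BodyguardsWin G k

BodyguardNumber : Graph → ℕ → Set
BodyguardNumber G m = Win G m × (∀ k → k < m → ¬ Win G k)

{-# OPTIONS --safe #-}
-- Lower bounds: a president who never leaves a vertex with d distinct neighbours cannot be
-- surrounded by fewer than d bodyguards (pigeonhole); P₂ □ P₂ has vertices of degree 2 and
-- P₂ □ Pₙ, n ≥ 3, has vertices of degree 3.
-- Upper bounds: on the 4-cycle P₂ □ P₂, two bodyguards standing on the two neighbours of the
-- president follow each of his moves, because both reflections of the square are automorphisms.
-- On P₂ □ Pₙ, three bodyguards sweep a wall (a whole column) rightwards with the president to
-- its right. Once he is within one column of the wall they stand on his vertex, the vertex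
-- across and one horizontal neighbour. From this open formation every move except a retreat to
-- the open side lets them close it, and the closed formation (across, left and right) surrounds
-- him and follows him forever. A potential that bounds sweeping and retreating makes this finite.
module Submission where

open import Defs
open import Data.Nat using (ℕ; _≤_)
open import Data.Product using (_×_)
open import Relation.Binary.PropositionalEquality using (_≡_)

open import Data.Bool using (Bool; true; false; if_then_else_; not)
open import Data.Empty using (⊥-elim)
open import Data.Fin as Fin using (Fin; zero; suc; toℕ; pred; opposite)
open import Data.Fin.Properties using (toℕ-injective; toℕ-inject₁; toℕ<n; all?; pigeonhole; <⇒≢)
open import Data.List as List using ()
open import Data.Nat as ℕ using (zero; suc; _<_; _+_; _∸_; z≤n; s≤s; _<?_)
import Data.Nat.Properties as ℕ
open import Data.Product using (_,_; ∃-syntax; proj₁; proj₂; map)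
open import Data.Product.Properties using (≡-dec)
open import Data.Sum using (_⊎_; inj₁; inj₂; [_,_]′)
open import Data.Unit using (⊤; tt)
open import Data.Vec.Functional using ([]; _∷_)
open import Function using (_∘_; id)
open import Function.Definitions using (Injective)
open import Relation.Binary.Core using (_Preserves_⟶_)
open import Relation.Binary.Definitions using (Decidable; DecidableEquality)
open import Relation.Binary.PropositionalEquality
  using (refl; sym; trans; cong; subst; _≢_; _≗_; module ≡-Reasoning)
open import Relation.Nullary using (yes; no; does; ¬_)
open import Relation.Nullary.Decidable
  using (True; toWitness; _×-dec_; _⊎-dec_; dec-true; dec-false)

-- Definitionally equal to Game.Step G k, the relation of a single token move.
Near : (G : Graph) → V G → V G → Set
Near G u v = u ≡ v ⊎ Adj G u v

near? : ∀ {G} → DecidableEquality (V G) → Decidable (Adj G) → Decidable (Near G)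
near? _≟_ adj? u v = (u ≟ v) ⊎-dec adj? u v

module _ {G H : Graph} where

  □-adj? : DecidableEquality (V G) → DecidableEquality (V H) →
           Decidable (Adj G) → Decidable (Adj H) → Decidable (Adj (G □ H))
  □-adj? _≟G_ _≟H_ adjG? adjH? (u , v) (x , y) =
    (adjG? u x ×-dec (v ≟H y)) ⊎-dec ((u ≟G x) ×-dec adjH? v y)

  near-□ˡ : ∀ {u x v} → Near G u x → Near (G □ H) (u , v) (x , v)
  near-□ˡ (inj₁ refl) = inj₁ refl
  near-□ˡ (inj₂ a)    = inj₂ (inj₁ (a , refl))

  near-□ʳ : ∀ {u v y} → Near H v y → Near (G □ H) (u , v) (u , y)
  near-□ʳ (inj₁ refl) = inj₁ refl
  near-□ʳ (inj₂ a)    = inj₂ (inj₂ (refl , a))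

  map-near : ∀ {f : V G → V G} {g : V H → V H} →
             f Preserves Near G ⟶ Near G → g Preserves Near H ⟶ Near H →
             map f g Preserves Near (G □ H) ⟶ Near (G □ H)
  map-near f-near g-near (inj₁ refl)              = inj₁ refl
  map-near f-near g-near (inj₂ (inj₁ (a , refl))) = near-□ˡ (f-near (inj₂ a))
  map-near f-near g-near (inj₂ (inj₂ (refl , a))) = near-□ʳ (g-near (inj₂ a))

module _ (G : Graph) {k : ℕ} where
  open Game G k

  stationary : V G → PStrategy
  stationary v = record { place = λ _ → v ; move = λ p _ _ → p ; legal = λ _ _ _ → inj₁ refl }

  ¬Win-if-unsurroundable : (v : V G) → (∀ b → ¬ Surrounded v b) → ¬ Win G k
  ¬Win-if-unsurroundable v unsurroundable (σ , wins) with wins (stationary v)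
  ... | T , surrounded = unsurroundable (guardsAfter σ (stationary v) T)
    (subst (λ p → Surrounded p (guardsAfter σ (stationary v) T)) (stays T) (surrounded T ℕ.≤-refl))
    where
    stays : ∀ t → presBefore σ (stationary v) t ≡ v
    stays zero    = refl
    stays (suc t) = stays t

  ¬Surrounded-below-degree : ∀ {d v} (nbr : Fin d → V G) → Injective _≡_ _≡_ nbr →
                             (∀ x → Adj G v (nbr x)) → k < d → ∀ b → ¬ Surrounded v b
  ¬Surrounded-below-degree {d} nbr nbr-injective adj k<d b surrounded =
    let i , j , i<j , same-guard = pigeonhole k<d guard in
    <⇒≢ i<j (nbr-injective (begin
      nbr i         ≡⟨ sym (guarded i) ⟩
      b (guard i)   ≡⟨ cong b same-guard ⟩
      b (guard j)   ≡⟨ guarded j ⟩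
      nbr j         ∎))
    where
    open ≡-Reasoning
    guard : Fin d → Fin k
    guard x = proj₁ (surrounded _ (adj x))
    guarded : ∀ x → b (guard x) ≡ nbr x
    guarded x = proj₂ (surrounded _ (adj x))

  ¬Win-below-degree : ∀ {d} v (nbr : Fin d → V G) → Injective _≡_ _≡_ nbr →
                      (∀ x → Adj G v (nbr x)) → k < d → ¬ Win G k
  ¬Win-below-degree v nbr nbr-injective adj k<d =
    ¬Win-if-unsurroundable v (¬Surrounded-below-degree nbr nbr-injective adj k<d)

eventually-zero : (f : ℕ → ℕ) → (∀ t → f (suc t) ≡ 0 ⊎ f (suc t) < f t) →
                  ∀ t → f 0 ≤ t → f t ≡ 0
eventually-zero f decreasing t f₀≤t =
  ℕ.n≤0⇒n≡0 (ℕ.≤-trans (bound t) (ℕ.≤-reflexive (ℕ.m≤n⇒m∸n≡0 f₀≤t)))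
  where
  bound : ∀ t → f t ≤ f 0 ∸ t
  bound zero = ℕ.≤-refl
  bound (suc t) with decreasing t
  ... | inj₁ vanished = subst (_≤ f 0 ∸ suc t) (sym vanished) z≤n
  ... | inj₂ smaller  = subst (f (suc t) ≤_) (ℕ.pred[m∸n]≡m∸[1+n] (f 0) t)
                              (ℕ.<⇒≤pred (ℕ.<-≤-trans smaller (bound t)))

module _ {G : Graph} {k : ℕ} where
  open Game G k

  module _ {Mode : Set} (formation : Mode → V G → Guards)
           (Valid : Mode → V G → Set) (potential : Mode → V G → ℕ) where

    record Transition (s : Mode) (q : V G) (s′ : Mode) (p : V G) : Set where
      field
        reachable  : ∀ i → Near G (formation s q i) (formation s′ p i)
        valid      : Valid s′ p
        decreasing : potential s′ p ≡ 0 ⊎ potential s′ p < potential s q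

  record Plan : Set₁ where
    field
      Mode       : Set
      formation  : Mode → V G → Guards
      Valid      : Mode → V G → Set
      potential  : Mode → V G → ℕ
      next       : Mode → V G → V G → Mode
      placement  : Guards
      initial    : V G → Mode
      initial-reachable : ∀ p i → Near G (placement i) (formation (initial p) p i)
      initial-valid     : ∀ p → Valid (initial p) p
      transition : ∀ {s q p} → Valid s q → Near G q p →
                   Transition formation Valid potential s q (next s q p) p
      surrounds  : ∀ {s q} → Valid s q → potential s q ≡ 0 → Surrounded q (formation s q)

  surrounded-resp : ∀ {q b b′} → b ≗ b′ → Surrounded q b → Surrounded q b′
  surrounded-resp b≗b′ surrounded v adj with surrounded v adj
  ... | i , bᵢ≡v = i , trans (sym (b≗b′ i)) bᵢ≡v

  module _ (near? : Decidable (Near G)) where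

    -- A move must be legal even for positions no play reaches, hence the fallback of staying put.
    approach : Guards → Guards → Guards
    approach b g with all? (λ i → near? (b i) (g i))
    ... | yes _ = g
    ... | no _  = b

    approach-legal : ∀ b g i → Near G (b i) (approach b g i)
    approach-legal b g i with all? (λ i → near? (b i) (g i))
    ... | yes b→g = b→g i
    ... | no _    = inj₁ refl

    approach-reaches : ∀ {b g} → (∀ i → Near G (b i) (g i)) → ∀ i → approach b g i ≡ g i
    approach-reaches {b} {g} b→g i with all? (λ i → near? (b i) (g i))
    ... | yes _    = refl
    ... | no ¬b→g = ⊥-elim (¬b→g b→g)

    plan-wins : Plan → Win G k
    plan-wins plan = strategy , wins
      where
      open Plan plan

      modeAfter : History → V G → Mode
      modeAfter List.[]             p = initial p
      modeAfter ((_ , q) List.∷ h) p = next (modeAfter h q) q p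

      strategy : BStrategy
      strategy = record
        { place = placement
        ; move  = λ b p h → approach b (formation (modeAfter h p) p)
        ; legal = λ b p h → approach-legal b _ }

      wins : ∀ τ → WinsAgainst strategy τ
      wins τ = potential (mode 0) (pres 0) , λ t T≤t →
        surrounded-resp (sym ∘ in-formation t)
                        (surrounds (valid t) (eventually-zero _ decreasing t T≤t))
        where
        pres : ℕ → V G
        pres = presBefore strategy τ

        mode : ℕ → Mode
        mode t = modeAfter (State.hist (play strategy τ t)) (pres t)

        moved : ∀ t → Near G (pres t) (pres (suc t))
        moved t = PStrategy.legal τ _ _ _

        valid : ∀ t → Valid (mode t) (pres t)
        valid zero    = initial-valid _
        valid (suc t) = Transition.valid (transition (valid t) (moved t))

        decreasing : ∀ t → potential (mode (suc t)) (pres (suc t)) ≡ 0 ⊎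
                           potential (mode (suc t)) (pres (suc t)) < potential (mode t) (pres t)
        decreasing t = Transition.decreasing (transition (valid t) (moved t))

        in-formation : ∀ t → guardsAfter strategy τ t ≗ formation (mode t) (pres t)
        in-formation zero    = approach-reaches (initial-reachable _)
        in-formation (suc t) = approach-reaches λ i →
          subst (λ g → Near G g (formation (mode (suc t)) (pres (suc t)) i))
                (sym (in-formation t i))
                (Transition.reachable (transition (valid t) (moved t)) i)

path-adj? : ∀ {n} → Decidable (PathAdj n)
path-adj? i j = (toℕ j ℕ.≟ suc (toℕ i)) ⊎-dec (toℕ i ℕ.≟ suc (toℕ j))

path-near-sym : ∀ {n} {i j : Fin n} → Near (Path n) i j → Near (Path n) j i
path-near-sym (inj₁ refl)     = inj₁ refl
path-near-sym (inj₂ (inj₁ e)) = inj₂ (inj₂ e)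
path-near-sym (inj₂ (inj₂ e)) = inj₂ (inj₁ e)

rows-near : (r r′ : Fin 2) → Near (Path 2) r r′
rows-near zero       zero       = inj₁ refl
rows-near zero       (suc zero) = inj₂ (inj₁ refl)
rows-near (suc zero) zero       = inj₂ (inj₂ refl)
rows-near (suc zero) (suc zero) = inj₁ refl

opposite-near : opposite Preserves Near (Path 2) ⟶ Near (Path 2)
opposite-near {r} {r′} _ = rows-near (opposite r) (opposite r′)

opposite-≢ : (r : Fin 2) → r ≢ opposite r
opposite-≢ zero       ()
opposite-≢ (suc zero) ()

adj⇒opposite : ∀ {r r′ : Fin 2} → PathAdj 2 r r′ → r′ ≡ opposite r
adj⇒opposite {zero}     {suc zero} _ = refl
adj⇒opposite {suc zero} {zero}     _ = refl
adj⇒opposite {zero}     {zero}     (inj₁ ())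
adj⇒opposite {zero}     {zero}     (inj₂ ())
adj⇒opposite {suc zero} {suc zero} (inj₁ ())
adj⇒opposite {suc zero} {suc zero} (inj₂ ())

_⋖_ : ∀ {n} → Fin n → Fin n → Set
i ⋖ j = toℕ j ≡ suc (toℕ i)

⋖⇒< : ∀ {n} {i j : Fin n} → i ⋖ j → toℕ i < toℕ j
⋖⇒< i⋖j = ℕ.≤-reflexive (sym i⋖j)

suc-near : ∀ {n} {i j : Fin n} → Near (Path n) i j → Near (Path (suc n)) (suc i) (suc j)
suc-near (inj₁ refl)     = inj₁ refl
suc-near (inj₂ (inj₁ e)) = inj₂ (inj₁ (cong suc e))
suc-near (inj₂ (inj₂ e)) = inj₂ (inj₂ (cong suc e))

up : ∀ {m} → Fin (suc m) → Fin (suc m)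
up {zero}  i       = i
up {suc m} zero    = suc zero
up {suc m} (suc i) = suc (up i)

near-up : ∀ {m} (i : Fin (suc m)) → Near (Path (suc m)) i (up i)
near-up {zero}  i       = inj₁ refl
near-up {suc m} zero    = inj₂ (inj₁ refl)
near-up {suc m} (suc i) = suc-near (near-up i)

near-pred : ∀ {n} (i : Fin n) → Near (Path n) i (pred i)
near-pred zero    = inj₁ refl
near-pred (suc i) = inj₂ (inj₂ (cong suc (sym (toℕ-inject₁ i))))

⋖⇒up≡ : ∀ {m} {i j : Fin (suc m)} → i ⋖ j → up i ≡ j
⋖⇒up≡ {suc m} {zero}  {suc zero}    _   = refl
⋖⇒up≡ {suc m} {suc i} {suc j}       i⋖j = cong suc (⋖⇒up≡ (ℕ.suc-injective i⋖j))
⋖⇒up≡ {zero}  {zero}  {zero}        ()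
⋖⇒up≡ {suc m} {zero}  {zero}        ()
⋖⇒up≡ {suc m} {zero}  {suc (suc j)} ()
⋖⇒up≡ {suc m} {suc i} {zero}        ()

⋖⇒pred≡ : ∀ {n} {i j : Fin n} → i ⋖ j → pred j ≡ i
⋖⇒pred≡ {j = suc j} i⋖j = toℕ-injective (trans (toℕ-inject₁ j) (ℕ.suc-injective i⋖j))

toℕ-up : ∀ {m} (i : Fin (suc m)) → toℕ i < m → toℕ (up i) ≡ suc (toℕ i)
toℕ-up {suc m} zero    _         = refl
toℕ-up {suc m} (suc i) (s≤s i<m) = cong suc (toℕ-up i i<m)

up-near : ∀ {m} → up Preserves Near (Path (suc m)) ⟶ Near (Path (suc m))
up-near (inj₁ refl)                           = inj₁ refl
up-near (inj₂ (inj₁ i⋖j)) rewrite ⋖⇒up≡ i⋖j = near-up _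
up-near (inj₂ (inj₂ j⋖i)) rewrite ⋖⇒up≡ j⋖i = path-near-sym (near-up _)

pred-near : ∀ {n} → pred Preserves Near (Path n) ⟶ Near (Path n)
pred-near (inj₁ refl)                             = inj₁ refl
pred-near (inj₂ (inj₁ i⋖j)) rewrite ⋖⇒pred≡ i⋖j = path-near-sym (near-pred _)
pred-near (inj₂ (inj₂ j⋖i)) rewrite ⋖⇒pred≡ j⋖i = near-pred _

module Square where

  Square : Graph
  Square = Path 2 □ Path 2

  open Game Square 2 using (Guards; Surrounded)

  square-near? : Decidable (Near Square)
  square-near? = near? (≡-dec Fin._≟_ Fin._≟_) (□-adj? Fin._≟_ Fin._≟_ path-adj? path-adj?)

  decide : ∀ {u v} {_ : True (square-near? u v)} → Near Square u v
  decide {_} {_} {u~v} = toWitness u~v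

  across beside : V Square → V Square
  across (r , c) = (opposite r , c)
  beside (r , c) = (r , opposite c)

  across-near : across Preserves Near Square ⟶ Near Square
  across-near = map-near {Path 2} {Path 2} opposite-near id

  beside-near : beside Preserves Near Square ⟶ Near Square
  beside-near = map-near {Path 2} {Path 2} id opposite-near

  adj-neighbours : ∀ {q v} → Adj Square q v → v ≡ across q ⊎ v ≡ beside q
  adj-neighbours (inj₁ (r~r′ , refl)) = inj₁ (cong (_, _) (adj⇒opposite r~r′))
  adj-neighbours (inj₂ (refl , c~c′)) = inj₂ (cong (_ ,_) (adj⇒opposite c~c′))

  neighbours : Bool → V Square → Guards
  neighbours false q = across q ∷ beside q ∷ []
  neighbours true  q = beside q ∷ across q ∷ []

  neighbours-near : ∀ swapped i →
                    (λ q → neighbours swapped q i) Preserves Near Square ⟶ Near Square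
  neighbours-near false zero       = across-near
  neighbours-near false (suc zero) = beside-near
  neighbours-near true  zero       = beside-near
  neighbours-near true  (suc zero) = across-near

  neighbours-surround : ∀ swapped q → Surrounded q (neighbours swapped q)
  neighbours-surround false q v adj with adj-neighbours adj
  ... | inj₁ refl = zero , refl
  ... | inj₂ refl = suc zero , refl
  neighbours-surround true  q v adj with adj-neighbours adj
  ... | inj₁ refl = suc zero , refl
  ... | inj₂ refl = zero , refl

  -- From the neighbours of (0,0), those of the opposite corner are reachable only in swapped order.
  swapped-start : V Square → Bool
  swapped-start p = does (≡-dec Fin._≟_ Fin._≟_ p (suc zero , suc zero))

  start-reachable : ∀ p i → Near Square (neighbours false (zero , zero) i)
                                        (neighbours (swapped-start p) p i)
  start-reachable (zero     , zero)     zero       = decide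
  start-reachable (zero     , zero)     (suc zero) = decide
  start-reachable (zero     , suc zero) zero       = decide
  start-reachable (zero     , suc zero) (suc zero) = decide
  start-reachable (suc zero , zero)     zero       = decide
  start-reachable (suc zero , zero)     (suc zero) = decide
  start-reachable (suc zero , suc zero) zero       = decide
  start-reachable (suc zero , suc zero) (suc zero) = decide

  plan : Plan {Square} {2}
  plan = record
    { Mode              = Bool
    ; formation         = neighbours
    ; Valid             = λ _ _ → ⊤
    ; potential         = λ _ _ → 0
    ; next              = λ swapped _ _ → swapped
    ; placement         = neighbours false (zero , zero)
    ; initial           = swapped-start
    ; initial-reachable = start-reachable
    ; initial-valid     = λ _ → tt
    ; transition        = λ {swapped} _ near → record
        { reachable = λ i → neighbours-near swapped i near ; valid = tt ; decreasing = inj₁ refl }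
    ; surrounds         = λ {swapped} {q} _ _ → neighbours-surround swapped q }

  bodyguards-win : Win Square 2
  bodyguards-win = plan-wins square-near? plan

module Ladder (m : ℕ) where

  Ladder : Graph
  Ladder = Path 2 □ Path (suc m)

  Vertex : Set
  Vertex = Fin 2 × Fin (suc m)

  open Game Ladder 3 using (Guards; Surrounded)

  ladder-near? : Decidable (Near Ladder)
  ladder-near? = near? (≡-dec Fin._≟_ Fin._≟_) (□-adj? Fin._≟_ Fin._≟_ path-adj? path-adj?)

  vertical : ∀ {j} (r r′ : Fin 2) → Near Ladder (r , j) (r′ , j)
  vertical r r′ = near-□ˡ {Path 2} {Path (suc m)} (rows-near r r′)

  horizontal : ∀ {r i j} → Near (Path (suc m)) i j → Near Ladder (r , i) (r , j)
  horizontal = near-□ʳ {Path 2} {Path (suc m)}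

  data Role : Set where
    here across leftOf rightOf : Role

  -- At an end of the ladder, leftOf or rightOf falls back on the president's own vertex
  -- (pred and up saturate); that side has no neighbour to guard.
  at : Role → Vertex → Vertex
  at here    (r , j) = (r , j)
  at across  (r , j) = (opposite r , j)
  at leftOf  (r , j) = (r , pred j)
  at rightOf (r , j) = (r , up j)

  at-near : ∀ x → at x Preserves Near Ladder ⟶ Near Ladder
  at-near here    = id
  at-near across  = map-near {Path 2} {Path (suc m)} opposite-near id
  at-near leftOf  = map-near {Path 2} {Path (suc m)} id pred-near
  at-near rightOf = map-near {Path 2} {Path (suc m)} id up-near

  adj-roles : ∀ {q v} → Adj Ladder q v → v ≡ at across q ⊎ v ≡ at leftOf q ⊎ v ≡ at rightOf q
  adj-roles (inj₁ (r~r′ , refl))      = inj₁ (cong (_, _) (adj⇒opposite r~r′))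
  adj-roles (inj₂ (refl , inj₁ j⋖j′)) = inj₂ (inj₂ (cong (_ ,_) (sym (⋖⇒up≡ j⋖j′))))
  adj-roles (inj₂ (refl , inj₂ j′⋖j)) = inj₂ (inj₁ (cong (_ ,_) (sym (⋖⇒pred≡ j′⋖j))))

  data Dir : Set where
    still cross stepLeft stepRight : Dir

  data Move : Dir → Vertex → Vertex → Set where
    stays     : ∀ {q} → Move still q q
    crosses   : ∀ {r j} → Move cross (r , j) (opposite r , j)
    goesLeft  : ∀ {r i j} → j ⋖ i → Move stepLeft (r , i) (r , j)
    goesRight : ∀ {r i j} → i ⋖ j → Move stepRight (r , i) (r , j)

  dirOf : Vertex → Vertex → Dir
  dirOf (r , i) (r′ , j) =
    if not (does (r Fin.≟ r′)) then cross
    else if does (toℕ j <? toℕ i) then stepLeft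
    else if does (toℕ i <? toℕ j) then stepRight
    else still

  move-near : ∀ {d q p} → Move d q p → Near Ladder q p
  move-near stays           = inj₁ refl
  move-near crosses         = vertical _ _
  move-near (goesLeft j⋖i)  = inj₂ (inj₂ (refl , inj₂ j⋖i))
  move-near (goesRight i⋖j) = inj₂ (inj₂ (refl , inj₁ i⋖j))

  classify : ∀ {q p} → Near Ladder q p → ∃[ d ] Move d q p
  classify (inj₁ refl)                      = still , stays
  classify {_ , _} {_ , _} (inj₂ (inj₁ (r~r′ , refl)))
    with refl ← adj⇒opposite r~r′          = cross , crosses
  classify (inj₂ (inj₂ (refl , inj₁ i⋖j))) = stepRight , goesRight i⋖j
  classify (inj₂ (inj₂ (refl , inj₂ j⋖i))) = stepLeft , goesLeft j⋖i

  dirOf-sound : ∀ {d q p} → Move d q p → dirOf q p ≡ d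
  dirOf-sound (stays {r , j})
    rewrite dec-true (r Fin.≟ r) refl | dec-false (toℕ j <? toℕ j) (ℕ.n≮n _) = refl
  dirOf-sound (crosses {r})
    rewrite dec-false (r Fin.≟ opposite r) (opposite-≢ r) = refl
  dirOf-sound (goesLeft {r} {i} {j} j⋖i)
    rewrite dec-true (r Fin.≟ r) refl | dec-true (toℕ j <? toℕ i) (⋖⇒< j⋖i) = refl
  dirOf-sound (goesRight {r} {i} {j} i⋖j)
    rewrite dec-true (r Fin.≟ r) refl | dec-false (toℕ j <? toℕ i) (ℕ.<⇒≯ (⋖⇒< i⋖j))
          | dec-true (toℕ i <? toℕ j) (⋖⇒< i⋖j) = refl

  near-move : ∀ {q p} → Near Ladder q p → Move (dirOf q p) q p
  near-move near with classify near
  ... | d , move = subst (λ d → Move d _ _) (sym (dirOf-sound move)) move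

  data Kind : Set where
    openLeft openRight closed : Kind

  Has : (Fin 3 → Role) → Role → Set
  Has f x = ∃[ i ] f i ≡ x

  Covers : Kind → (Fin 3 → Role) → Set
  Covers openLeft  f = Has f here   × Has f across × Has f rightOf
  Covers openRight f = Has f here   × Has f across × Has f leftOf
  Covers closed    f = Has f leftOf × Has f across × Has f rightOf

  nextKind : Kind → Dir → Kind
  nextKind openLeft  stepLeft  = openLeft
  nextKind openRight stepRight = openRight
  nextKind _         _         = closed

  -- Unless the president retreats to the open side, the guard on his vertex steps into it;
  -- after a cross it is the guard across (now on his vertex) that does so.
  reassign : Kind → Dir → Role → Role
  reassign _         _         leftOf  = leftOf
  reassign _         _         rightOf = rightOf
  reassign openLeft  still     here    = leftOf
  reassign openLeft  cross     here    = across
  reassign openLeft  stepRight here    = leftOf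
  reassign openLeft  cross     across  = leftOf
  reassign openRight still     here    = rightOf
  reassign openRight cross     here    = across
  reassign openRight stepLeft  here    = rightOf
  reassign openRight cross     across  = rightOf
  reassign _         _         x       = x

  Has-reassign : ∀ {k d f x} → Has f x → Has (reassign k d ∘ f) (reassign k d x)
  Has-reassign {k} {d} (i , fᵢ≡x) = i , cong (reassign k d) fᵢ≡x

  covers-next : ∀ k d f → Covers k f → Covers (nextKind k d) (reassign k d ∘ f)
  covers-next openLeft  still     _ (h , a , r) = Has-reassign h , Has-reassign a , Has-reassign r
  covers-next openLeft  cross     _ (h , a , r) = Has-reassign a , Has-reassign h , Has-reassign r
  covers-next openLeft  stepLeft  _ (h , a , r) = Has-reassign h , Has-reassign a , Has-reassign r
  covers-next openLeft  stepRight _ (h , a , r) = Has-reassign h , Has-reassign a , Has-reassign r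
  covers-next openRight still     _ (h , a , l) = Has-reassign l , Has-reassign a , Has-reassign h
  covers-next openRight cross     _ (h , a , l) = Has-reassign l , Has-reassign h , Has-reassign a
  covers-next openRight stepLeft  _ (h , a , l) = Has-reassign l , Has-reassign a , Has-reassign h
  covers-next openRight stepRight _ (h , a , l) = Has-reassign h , Has-reassign a , Has-reassign l
  covers-next closed    _         _ (l , a , r) = Has-reassign l , Has-reassign a , Has-reassign r

  follows : ∀ x {d q p} → Move d q p → Near Ladder (at x q) (at x p)
  follows x = at-near x ∘ move-near

  reassign-near : ∀ k x {d q p} → Move d q p → Near Ladder (at x q) (at (reassign k d x) p)
  reassign-near _         leftOf  move               = follows leftOf move
  reassign-near _         rightOf move               = follows rightOf move
  reassign-near openLeft  here    stays              = horizontal (near-pred _)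
  reassign-near openLeft  here    crosses            = vertical _ _
  reassign-near openLeft  here    (goesRight i⋖j)    = inj₁ (cong (_ ,_) (sym (⋖⇒pred≡ i⋖j)))
  reassign-near openLeft  here    move@(goesLeft _)  = follows here move
  reassign-near openLeft  across  crosses            = horizontal (near-pred _)
  reassign-near openLeft  across  move@stays         = follows across move
  reassign-near openLeft  across  move@(goesLeft _)  = follows across move
  reassign-near openLeft  across  move@(goesRight _) = follows across move
  reassign-near openRight here    stays              = horizontal (near-up _)
  reassign-near openRight here    crosses            = vertical _ _
  reassign-near openRight here    (goesLeft j⋖i)     = inj₁ (cong (_ ,_) (sym (⋖⇒up≡ j⋖i)))
  reassign-near openRight here    move@(goesRight _) = follows here move
  reassign-near openRight across  crosses            = horizontal (near-up _)
  reassign-near openRight across  move@stays         = follows across move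
  reassign-near openRight across  move@(goesLeft _)  = follows across move
  reassign-near openRight across  move@(goesRight _) = follows across move
  reassign-near closed    here    move               = follows here move
  reassign-near closed    across  move               = follows across move

  chasePotential : Kind → Vertex → ℕ
  chasePotential openLeft  (_ , j) = suc (toℕ j)
  chasePotential openRight (_ , j) = suc (m ∸ toℕ j)
  chasePotential closed    _       = 0

  chase-decreases : ∀ k {d q p} → Move d q p →
                    chasePotential (nextKind k d) p ≡ 0 ⊎
                    chasePotential (nextKind k d) p < chasePotential k q
  chase-decreases openLeft  stays                   = inj₁ refl
  chase-decreases openLeft  crosses                 = inj₁ refl
  chase-decreases openLeft  (goesLeft j⋖i)          = inj₂ (s≤s (⋖⇒< j⋖i))
  chase-decreases openLeft  (goesRight _)           = inj₁ refl
  chase-decreases openRight stays                   = inj₁ refl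
  chase-decreases openRight crosses                 = inj₁ refl
  chase-decreases openRight (goesLeft _)            = inj₁ refl
  chase-decreases openRight (goesRight {j = j} i⋖j) =
    inj₂ (s≤s (ℕ.∸-monoʳ-< (⋖⇒< i⋖j) (ℕ.s≤s⁻¹ (toℕ<n j))))
  chase-decreases closed    _                       = inj₁ refl

  -- Two guards on row 0, so that both open formations are one step away from the wall
  -- whichever row the president is in.
  wall : Fin (suc m) → Guards
  wall c = (zero , c) ∷ (suc zero , c) ∷ (zero , c) ∷ []

  rolesAtWall rolesAhead : Fin 2 → Fin 3 → Role
  rolesAtWall zero       = here   ∷ across  ∷ rightOf ∷ []
  rolesAtWall (suc zero) = across ∷ rightOf ∷ here    ∷ []
  rolesAhead  zero       = here   ∷ across  ∷ leftOf  ∷ []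
  rolesAhead  (suc zero) = across ∷ here    ∷ leftOf  ∷ []

  rolesAtWall-covers : ∀ r → Covers openLeft (rolesAtWall r)
  rolesAtWall-covers zero       = (zero , refl) , (suc zero , refl) , (suc (suc zero) , refl)
  rolesAtWall-covers (suc zero) = (suc (suc zero) , refl) , (zero , refl) , (suc zero , refl)

  rolesAhead-covers : ∀ r → Covers openRight (rolesAhead r)
  rolesAhead-covers zero       = (zero , refl) , (suc zero , refl) , (suc (suc zero) , refl)
  rolesAhead-covers (suc zero) = (suc zero , refl) , (zero , refl) , (suc (suc zero) , refl)

  rolesAtWall-reachable : ∀ r c i → Near Ladder (wall c i) (at (rolesAtWall r i) (r , c))
  rolesAtWall-reachable zero       c zero             = inj₁ refl
  rolesAtWall-reachable zero       c (suc zero)       = inj₁ refl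
  rolesAtWall-reachable zero       c (suc (suc zero)) = horizontal (near-up c)
  rolesAtWall-reachable (suc zero) c zero             = inj₁ refl
  rolesAtWall-reachable (suc zero) c (suc zero)       = horizontal (near-up c)
  rolesAtWall-reachable (suc zero) c (suc (suc zero)) = vertical _ _

  rolesAhead-reachable : ∀ r {c j} → c ⋖ j → ∀ i → Near Ladder (wall c i) (at (rolesAhead r i) (r , j))
  rolesAhead-reachable zero       c⋖j zero             = horizontal (inj₂ (inj₁ c⋖j))
  rolesAhead-reachable zero       c⋖j (suc zero)       = horizontal (inj₂ (inj₁ c⋖j))
  rolesAhead-reachable zero       c⋖j (suc (suc zero)) = inj₁ (cong (zero ,_) (sym (⋖⇒pred≡ c⋖j)))
  rolesAhead-reachable (suc zero) c⋖j zero             = horizontal (inj₂ (inj₁ c⋖j))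
  rolesAhead-reachable (suc zero) c⋖j (suc zero)       = horizontal (inj₂ (inj₁ c⋖j))
  rolesAhead-reachable (suc zero) c⋖j (suc (suc zero)) rewrite ⋖⇒pred≡ c⋖j = vertical _ _

  wall-advances : ∀ c i → Near Ladder (wall c i) (wall (up c) i)
  wall-advances c zero             = horizontal (near-up c)
  wall-advances c (suc zero)       = horizontal (near-up c)
  wall-advances c (suc (suc zero)) = horizontal (near-up c)

  data Mode : Set where
    sweep : Fin (suc m) → Mode
    chase : Kind → (Fin 3 → Role) → Mode

  formation : Mode → Vertex → Guards
  formation (sweep c)   _ = wall c
  formation (chase _ f) q = λ i → at (f i) q

  Valid : Mode → Vertex → Set
  Valid (sweep c)   (_ , j) = toℕ c < toℕ j
  Valid (chase k f) _       = Covers k f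

  potential : Mode → Vertex → ℕ
  potential (sweep c)   _ = suc m + suc (m ∸ toℕ c)
  potential (chase k _) q = chasePotential k q

  sweepNext : Fin (suc m) → Vertex → Mode
  sweepNext c (r , j) with j Fin.≟ c | toℕ j ℕ.≟ suc (toℕ c)
  ... | yes _ | _     = chase openLeft (rolesAtWall r)
  ... | no _  | yes _ = chase openRight (rolesAhead r)
  ... | no _  | no _  = sweep (up c)

  next : Mode → Vertex → Vertex → Mode
  next (sweep c)   _ p = sweepNext c p
  next (chase k f) q p = chase (nextKind k (dirOf q p)) (reassign k (dirOf q p) ∘ f)

  LadderTransition : Mode → Vertex → Mode → Vertex → Set
  LadderTransition = Transition {Ladder} {3} formation Valid potential

  below-sweep : ∀ {x} (c : Fin (suc m)) → x ≤ suc m → x < suc m + suc (m ∸ toℕ c)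
  below-sweep c x≤1+m = ℕ.≤-<-trans x≤1+m (ℕ.m<m+n (suc m) (s≤s z≤n))

  sweep-transition : ∀ c {q} p → toℕ c ≤ toℕ (proj₂ p) →
                     LadderTransition (sweep c) q (sweepNext c p) p
  sweep-transition c (r , j) c≤j with j Fin.≟ c | toℕ j ℕ.≟ suc (toℕ c)
  ... | yes refl | _ = record
    { reachable  = rolesAtWall-reachable r c
    ; valid      = rolesAtWall-covers r
    ; decreasing = inj₂ (below-sweep c (toℕ<n c)) }
  ... | no _ | yes c⋖j = record
    { reachable  = rolesAhead-reachable r c⋖j
    ; valid      = rolesAhead-covers r
    ; decreasing = inj₂ (below-sweep c (s≤s (ℕ.m∸n≤m m (toℕ j)))) }
  ... | no j≢c | no ¬c⋖j = record
    { reachable  = wall-advances c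
    ; valid      = subst (_< toℕ j) (sym (toℕ-up c c<m)) c+1<j
    ; decreasing = inj₂ (subst (λ x → suc m + suc (m ∸ x) < suc m + suc (m ∸ toℕ c))
                               (sym (toℕ-up c c<m))
                               (ℕ.+-monoʳ-< (suc m) (s≤s (ℕ.∸-monoʳ-< (ℕ.n<1+n _) c<m)))) }
    where
    c+1<j : suc (toℕ c) < toℕ j
    c+1<j = ℕ.≤∧≢⇒< (ℕ.≤∧≢⇒< c≤j (j≢c ∘ toℕ-injective ∘ sym)) (¬c⋖j ∘ sym)
    c<m : toℕ c < m
    c<m = ℕ.≤-trans (ℕ.<⇒≤ c+1<j) (ℕ.s≤s⁻¹ (toℕ<n j))

  chase-transition : ∀ k f {q p} → Covers k f → Near Ladder q p →
                     LadderTransition (chase k f) q (next (chase k f) q p) p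
  chase-transition k f covers near = record
    { reachable  = λ i → reassign-near k (f i) (near-move near)
    ; valid      = covers-next k _ f covers
    ; decreasing = chase-decreases k (near-move near) }

  near-column-≤ : ∀ {r r′ j j′} → Near Ladder (r , j) (r′ , j′) → toℕ j ≤ suc (toℕ j′)
  near-column-≤ (inj₁ refl)                   = ℕ.n≤1+n _
  near-column-≤ (inj₂ (inj₁ (_ , refl)))      = ℕ.n≤1+n _
  near-column-≤ (inj₂ (inj₂ (_ , inj₁ j⋖j′))) = ℕ.m≤n⇒m≤1+n (ℕ.<⇒≤ (⋖⇒< j⋖j′))
  near-column-≤ (inj₂ (inj₂ (_ , inj₂ j′⋖j))) = ℕ.≤-reflexive j′⋖j

  transition : ∀ {s q p} → Valid s q → Near Ladder q p → LadderTransition s q (next s q p) p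
  transition {sweep c} {_ , _} {_ , _} c<j near =
    sweep-transition c _ (ℕ.s≤s⁻¹ (ℕ.<-≤-trans c<j (near-column-≤ near)))
  transition {chase k f} covers near = chase-transition k f covers near

  occupied : ∀ {f x q v} → Has f x → v ≡ at x q → ∃[ i ] at (f i) q ≡ v
  occupied (i , fᵢ≡x) refl = i , cong (λ y → at y _) fᵢ≡x

  surrounds : ∀ {s q} → Valid s q → potential s q ≡ 0 → Surrounded q (formation s q)
  surrounds {chase closed _} (l , a , r) _ _ adj =
    [ occupied a , [ occupied l , occupied r ]′ ]′ (adj-roles adj)
  surrounds {sweep _}           _ ()
  surrounds {chase openLeft _}  _ ()
  surrounds {chase openRight _} _ ()

  plan : Plan {Ladder} {3}
  plan = record
    { Mode              = Mode
    ; formation         = formation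
    ; Valid             = Valid
    ; potential         = potential
    ; next              = next
    ; placement         = wall zero
    ; initial           = sweepNext zero
    ; initial-reachable = λ p → Transition.reachable (sweep-transition zero {p} p z≤n)
    ; initial-valid     = λ p → Transition.valid (sweep-transition zero {p} p z≤n)
    ; transition        = λ {s} → transition {s}
    ; surrounds         = λ {s} → surrounds {s} }

  bodyguards-win : Win Ladder 3
  bodyguards-win = plan-wins ladder-near? plan

¬Win-square : ∀ {k} → k < 2 → ¬ Win (Path 2 □ Path 2) k
¬Win-square = ¬Win-below-degree (Path 2 □ Path 2) (zero , zero) nbr nbr-injective adj
  where
  nbr : Fin 2 → Fin 2 × Fin 2
  nbr = (suc zero , zero) ∷ (zero , suc zero) ∷ []
  nbr-injective : Injective _≡_ _≡_ nbr
  nbr-injective {zero}     {zero}     _  = refl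
  nbr-injective {suc zero} {suc zero} _  = refl
  nbr-injective {zero}     {suc zero} ()
  nbr-injective {suc zero} {zero}     ()
  adj : ∀ x → Adj (Path 2 □ Path 2) (zero , zero) (nbr x)
  adj zero       = inj₁ (inj₁ refl , refl)
  adj (suc zero) = inj₂ (refl , inj₁ refl)

¬Win-ladder : ∀ m {k} → k < 3 → ¬ Win (Path 2 □ Path (3 + m)) k
¬Win-ladder m = ¬Win-below-degree (Path 2 □ Path (3 + m)) (zero , suc zero) nbr nbr-injective adj
  where
  nbr : Fin 3 → Fin 2 × Fin (3 + m)
  nbr = (suc zero , suc zero) ∷ (zero , zero) ∷ (zero , suc (suc zero)) ∷ []
  nbr-injective : Injective _≡_ _≡_ nbr
  nbr-injective {zero}           {zero}           _  = refl
  nbr-injective {suc zero}       {suc zero}       _  = refl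
  nbr-injective {suc (suc zero)} {suc (suc zero)} _  = refl
  nbr-injective {zero}           {suc zero}       ()
  nbr-injective {zero}           {suc (suc zero)} ()
  nbr-injective {suc zero}       {zero}           ()
  nbr-injective {suc zero}       {suc (suc zero)} ()
  nbr-injective {suc (suc zero)} {zero}           ()
  nbr-injective {suc (suc zero)} {suc zero}       ()
  adj : ∀ x → Adj (Path 2 □ Path (3 + m)) (zero , suc zero) (nbr x)
  adj zero             = inj₁ (inj₁ refl , refl)
  adj (suc zero)       = inj₂ (refl , inj₂ refl)
  adj (suc (suc zero)) = inj₂ (refl , inj₁ refl)

lemma4p2 : (n : ℕ) → 2 ≤ n →
    (n ≡ 2 → BodyguardNumber (Path 2 □ Path n) 2) ×
    (3 ≤ n → BodyguardNumber (Path 2 □ Path n) 3)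
lemma4p2 n _ = square , ladder
  where
  square : n ≡ 2 → BodyguardNumber (Path 2 □ Path n) 2
  square refl = Square.bodyguards-win , λ _ → ¬Win-square
  ladder : 3 ≤ n → BodyguardNumber (Path 2 □ Path n) 3
  ladder (s≤s (s≤s (s≤s {n = m} _))) = Ladder.bodyguards-win (2 + m) , λ _ → ¬Win-ladder m
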